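{- Let $(S,x)$ be a solution of UnifFLPP in which $x$ is a minimum-cost assignment for $S$, let $(S^*,x^*)$ be an optimum solution, and fix a path decomposition $P$ as described in the context. If no operation $\mathrm{swap}(s,t)$ ($s\in S$, $t\notin S$) is admissible, then $$c_f(H)\le 2v(Sw(H,\cdot))+2c_f(S^*\setminus S)+v(Tr(H,\cdot))+v(Pen(H)).$$
   Context: UnifFLPP: finite facility set $F$, finite client set $C$, metric distances $c_{ij}\ge0$ on $F\cup C$; facility $i$ has opening cost $f_i\ge0$ and capacity $U$ (same for all); client $j$ has demand $d_j\ge0$ and penalty $p_j\ge0$ per unit of unserved demand. A solution is $S\subseteq F$ with an assignment $x(i,j)\ge0$ ($i\in S$) satisfying $\sum_j x(i,j)\le U$ and $\sum_{i\in S}x(i,j)\le d_j$; $c_f(S)=\sum_{i\in S}f_i$, cost $=c_f(S)+\sum_{i,j}c_{ij}x(i,j)+\sum_j p_j(d_j-\sum_i x(i,j))$; the cost of a set $S$ is the minimum cost over assignments for $S$. $\mathrm{swap}(s,t)$ replaces $S$ by $S\cup\{t\}\setminus\{s\}$; it is admissible if the resulting set has strictly smaller cost than $(S,x)$. For $A\subseteq F$, $c_f(A)=\sum_{i\in A}f_i$. Path decomposition: add a dummy facility $N$ to $S$ with $x(N,j)=d_j-\sum_{i\in S}x(i,j)$ and a dummy facility $N^*$ to $S^*$ with $x^*(N^*,j)=d_j-\sum_{i\in S^*}x^*(i,j)$ (set $x(N^*,j)=x^*(N,j)=0$, $x(i,j)=0$ for $i\notin S$, $x^*(i,j)=0$ for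 $i\notin S^*$). On the bipartite graph between $F\cup\{N,N^*\}$ and $C$, consider the flow $x-x^*$: the edge $(i,j)$ carries $x(i,j)-x^*(i,j)$ units from $i$ to $j$ (a negative value means flow from $j$ to $i$). Edge $(i,j)$ with $i\in F$ has unit cost $c_{ij}$; edges $(N,j)$ and $(N^*,j)$ have unit cost $p_j$. Decompose this flow (after cancelling cycles, which have zero cost) into a set $P$ of paths, each with a weight $w(p)>0$, each starting at a vertex of $S\cup\{N\}$ and ending at a vertex of $S^*\cup\{N^*\}$, and such that on each edge the total weight of paths using it equals the absolute value of the flow on it. The cost $c(p)$ of a path is the sum of unit costs of its edges. For a set $P'$ of paths, $w(P')=\sum_{p\in P'}w(p)$ and $v(P')=\sum_{p\in P'}w(p)c(p)$. For $s\in S\setminus S^*$: $Sw(s,\cdot)$ (swap paths) is the set of paths from $s$ ending in $S^*\setminus S$; $Tr(s,\cdot)$ (transfer paths) is the set of paths from $s$ ending in $S\cap S^*$; $Pen(s)$ (penalty paths) is the set of paths from $s$ ending at $N^*$. For $A\subseteq S\setminus S^*$, $Sw(A,\cdot)=\bigcup_{s\in A}Sw(s,\cdot)$, and similarly $Tr(A,\cdot)$, $Pen(A)$. A facility $s\in S\setminus S^*$ with $w(Sw(s,\cdot))>0$ is heavy if $w(Sw(s,\cdot))\ge U/2$ and light otherwise; $H$ denotes the set of heavy facilities.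
   Formalization: The distances $c_{ij}$, opening costs $f_i$, capacity $U$, demands $d_j$, penalties $p_j$, assignments and path weights all take values in the rationals. -}

module Defs where

open import Data.Nat using (ℕ; zero; suc)
open import Data.Fin as Fin using (Fin)
open import Data.Fin.Subset using (Subset; _∈_; _∉_; _∪_; ⁅_⁆; _-_)
open import Data.Fin.Subset.Properties using (_∈?_)
open import Data.Bool using (Bool; true; false; if_then_else_; _∧_; not)
open import Data.Rational as ℚ using (ℚ; 0ℚ; ½; ∣_∣) renaming (_+_ to _+ℚ_; _*_ to _*ℚ_; _-_ to _-ℚ_; -_ to -ℚ_)
open import Data.Rational.Properties using (_≤?_; _<?_)
open import Data.List using (List; []; _∷_; map)
open import Data.List.Relation.Unary.All using (All)
open import Data.List.Relation.Unary.Unique.Propositional using (Unique)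
open import Data.Product using (_×_; _,_; proj₁; proj₂)
open import Data.Unit using (⊤)
open import Data.Empty using (⊥)
open import Relation.Nullary using (does)
open import Relation.Binary.PropositionalEquality using (_≡_)

ΣFin : ∀ {n} → (Fin n → ℚ) → ℚ
ΣFin {zero} f = 0ℚ
ΣFin {suc n} f = f Fin.zero +ℚ ΣFin (λ i → f (Fin.suc i))

ΣList : ∀ {A : Set} → (A → ℚ) → List A → ℚ
ΣList f [] = 0ℚ
ΣList f (a ∷ as) = f a +ℚ ΣList f as

2ℚ : ℚ
2ℚ = ℚ.1ℚ +ℚ ℚ.1ℚ

when : Bool → ℚ → ℚ
when b q = if b then q else 0ℚ

data Pt (nF nC : ℕ) : Set where
  fpt : Fin nF → Pt nF nC
  cpt : Fin nC → Pt nF nC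

record Instance (nF nC : ℕ) : Set where
  field
    dist        : Pt nF nC → Pt nF nC → ℚ
    dist-nonneg : ∀ a b → 0ℚ ℚ.≤ dist a b
    dist-self   : ∀ a → dist a a ≡ 0ℚ
    dist-sym    : ∀ a b → dist a b ≡ dist b a
    dist-tri    : ∀ a b e → dist a e ℚ.≤ dist a b +ℚ dist b e
    fcost       : Fin nF → ℚ
    fcost-nonneg : ∀ i → 0ℚ ℚ.≤ fcost i
    U           : ℚ
    U-nonneg    : 0ℚ ℚ.≤ U
    dem         : Fin nC → ℚ
    dem-nonneg  : ∀ j → 0ℚ ℚ.≤ dem j
    pen         : Fin nC → ℚ
    pen-nonneg  : ∀ j → 0ℚ ℚ.≤ pen j

  c : Fin nF → Fin nC → ℚ
  c i j = dist (fpt i) (cpt j)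

Assign : ℕ → ℕ → Set
Assign nF nC = Fin nF → Fin nC → ℚ

module _ {nF nC : ℕ} (I : Instance nF nC) where
  open Instance I

  cf : Subset nF → ℚ
  cf A = ΣFin (λ i → when (does (i ∈? A)) (fcost i))

  served : Assign nF nC → Fin nC → ℚ
  served x j = ΣFin (λ i → x i j)

  Feasible : Subset nF → Assign nF nC → Set
  Feasible S x =
      (∀ i j → 0ℚ ℚ.≤ x i j)
    × (∀ i j → i ∉ S → x i j ≡ 0ℚ)
    × (∀ i → ΣFin (λ j → x i j) ℚ.≤ U)
    × (∀ j → served x j ℚ.≤ dem j)

  cost : Subset nF → Assign nF nC → ℚ
  cost S x = cf S
           +ℚ ΣFin (λ i → ΣFin (λ j → c i j *ℚ x i j))
           +ℚ ΣFin (λ j → pen j *ℚ (dem j -ℚ served x j))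

  MinCostFor : Subset nF → Assign nF nC → Set
  MinCostFor S x = ∀ x' → Feasible S x' → cost S x ℚ.≤ cost S x'

  Optimal : Subset nF → Assign nF nC → Set
  Optimal S x = ∀ S' x' → Feasible S' x' → cost S x ℚ.≤ cost S' x'

  swapSet : Subset nF → Fin nF → Fin nF → Subset nF
  swapSet S s t = (S ∪ ⁅ t ⁆) - s

  NoAdmissibleSwap : Subset nF → Assign nF nC → Set
  NoAdmissibleSwap S x = ∀ s t → s ∈ S → t ∉ S →
    ∀ x' → Feasible (swapSet S s t) x' → cost S x ℚ.≤ cost (swapSet S s t) x'

data FV (nF : ℕ) : Set where
  fac : Fin nF → FV nF
  dN  : FV nF
  dN* : FV nF

data Dir : Set where
  fwd bwd : Dir   -- fwd: facility → client ; bwd: client → facility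

-- a path a₀ → j₁ → a₁ → j₂ → a₂ → … → a_k, alternating
-- facility-side vertices and clients
record Path (nF nC : ℕ) : Set where
  constructor path
  field
    start : FV nF
    steps : List (Fin nC × FV nF)

  endAux : FV nF → List (Fin nC × FV nF) → FV nF
  endAux a [] = a
  endAux a ((j , b) ∷ r) = endAux b r

  end : FV nF
  end = endAux start steps

  edgesAux : FV nF → List (Fin nC × FV nF) → List (FV nF × Fin nC × Dir)
  edgesAux a [] = []
  edgesAux a ((j , b) ∷ r) = (a , j , fwd) ∷ (b , j , bwd) ∷ edgesAux b r

  edges : List (FV nF × Fin nC × Dir)
  edges = edgesAux start steps

  facVertices : List (FV nF)
  facVertices = start ∷ map proj₂ steps

  cliVertices : List (Fin nC)
  cliVertices = map proj₁ steps

open Path public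

eqFV : ∀ {nF} → FV nF → FV nF → Bool
eqFV (fac i) (fac k) = does (i Fin.≟ k)
eqFV dN dN = true
eqFV dN* dN* = true
eqFV _ _ = false

module _ {nF nC : ℕ} (I : Instance nF nC)
         (S S* : Subset nF) (x x* : Assign nF nC) where
  open Instance I

  flow : FV nF → Fin nC → ℚ
  flow (fac i) j = x i j -ℚ x* i j
  flow dN j = dem j -ℚ served I x j          -- x(N,j) − x*(N,j)
  flow dN* j = -ℚ (dem j -ℚ served I x* j)  -- x(N*,j) − x*(N*,j)

  ucost : FV nF → Fin nC → ℚ
  ucost (fac i) j = c i j
  ucost dN j = pen j
  ucost dN* j = pen j

  pathCost : Path nF nC → ℚ
  pathCost p = ΣList (λ { (a , j , _) → ucost a j }) (edges p)

  StartOK : FV nF → Set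
  StartOK (fac i) = i ∈ S
  StartOK dN = ⊤
  StartOK dN* = ⊥

  EndOK : FV nF → Set
  EndOK (fac i) = i ∈ S*
  EndOK dN = ⊥
  EndOK dN* = ⊤

  Conforming : FV nF × Fin nC × Dir → Set
  Conforming (a , j , fwd) = 0ℚ ℚ.< flow a j
  Conforming (a , j , bwd) = flow a j ℚ.< 0ℚ

  ValidPath : ℚ × Path nF nC → Set
  ValidPath (w , p) =
      (0ℚ ℚ.< w)
    × StartOK (start p)
    × EndOK (end p)
    × Unique (facVertices p)
    × Unique (cliVertices p)
    × All Conforming (edges p)

  matchE : FV nF → Fin nC → FV nF × Fin nC × Dir → Bool
  matchE a j (b , k , _) = eqFV a b ∧ does (j Fin.≟ k)

  usedW : List (ℚ × Path nF nC) → FV nF → Fin nC → ℚ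
  usedW P a j = ΣList (λ { (w , p) → ΣList (λ e → when (matchE a j e) w) (edges p) }) P

  pathFlow : List (ℚ × Path nF nC) → FV nF → Fin nC → ℚ
  pathFlow P a j = ΣList (λ { (w , p) → ΣList (sgn w) (edges p) }) P
    where
    sgn : ℚ → FV nF × Fin nC × Dir → ℚ
    sgn w e@(_ , _ , fwd) = when (matchE a j e) w
    sgn w e@(_ , _ , bwd) = -ℚ (when (matchE a j e) w)

  residual : List (ℚ × Path nF nC) → FV nF → Fin nC → ℚ
  residual P a j = flow a j -ℚ pathFlow P a j

  -- P is a path decomposition of x − x* after cancelling cycles:
  -- the paths are valid and flow-conforming, on every edge they use at
  -- most |x − x*|, and the cancelled part (x − x*) − (path flow) is a
  -- circulation (flow conservation at every vertex).
  IsPathDecomp : List (ℚ × Path nF nC) → Set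
  IsPathDecomp P =
      All ValidPath P
    × (∀ a j → usedW P a j ℚ.≤ ∣ flow a j ∣)
    × (∀ a → ΣFin (λ j → residual P a j) ≡ 0ℚ)
    × (∀ j → ΣFin (λ i → residual P (fac i) j)
               +ℚ residual P dN j +ℚ residual P dN* j ≡ 0ℚ)

  startsAt : Fin nF → Path nF nC → Bool
  startsAt s p = eqFV (fac s) (start p)

  endsSw : Path nF nC → Bool
  endsSw p with end p
  ... | fac t = does (t ∈? S*) ∧ not (does (t ∈? S))
  ... | _ = false

  endsTr : Path nF nC → Bool
  endsTr p with end p
  ... | fac t = does (t ∈? S*) ∧ does (t ∈? S)
  ... | _ = false

  endsPen : Path nF nC → Bool
  endsPen p = eqFV dN* (end p)

  module _ (P : List (ℚ × Path nF nC)) where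

    wSw : Fin nF → ℚ
    wSw s = ΣList (λ { (w , p) → when (startsAt s p ∧ endsSw p) w }) P

    heavy : Fin nF → Bool
    heavy s = does (s ∈? S) ∧ not (does (s ∈? S*))
            ∧ does (0ℚ <? wSw s) ∧ does ((U ℚ.* ½) ≤? wSw s)

    startsH : Path nF nC → Bool
    startsH p with start p
    ... | fac s = heavy s
    ... | _ = false

    cfH : ℚ
    cfH = ΣFin (λ s → when (heavy s) (fcost s))

    cfS*∖S : ℚ
    cfS*∖S = ΣFin (λ i → when (does (i ∈? S*) ∧ not (does (i ∈? S))) (fcost i))

    vClass : (Path nF nC → Bool) → ℚ
    vClass ends = ΣList (λ { (w , p) → when (startsH p ∧ ends p) (w *ℚ pathCost p) }) P

    vSwH vTrH vPenH : ℚ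
    vSwH = vClass endsSw
    vTrH = vClass endsTr
    vPenH = vClass endsPen

module Submission where

open import Defs
open import Data.Fin.Subset using (Subset)
open import Data.List using (List)
open import Data.Product using (_×_)
open import Data.Rational using (ℚ; _≤_; _+_; _*_)

open import Algebra.Bundles using (CommutativeRing)
open import Data.Bool using (Bool; true; false; T; not; _∧_)
open import Data.Bool.Properties using (T-∧)
open import Data.Empty using (⊥-elim)
open import Data.Fin as Fin using (Fin)
open import Data.Fin.Subset as Subset using (_∈_; _∉_; _∪_; ⁅_⁆)
open import Data.Fin.Subset.Properties
  using (_∈?_; x∈p∪q⁺; x∈p∪q⁻; x∈⁅x⁆; x∈⁅y⁆⇒x≡y; p─q⊆p; x∈p∧x≢y⇒x∈p-y)
open import Data.List using ([]; _∷_)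
open import Data.List.Membership.Propositional using () renaming (_∈_ to _∈ₗ_)
open import Data.List.Relation.Unary.All using (All; []; _∷_)
open import Data.List.Relation.Unary.Any using (here; there)
open import Data.Nat using (zero; suc)
open import Data.Product using (∃; _,_; proj₁; proj₂)
open import Data.Rational using (0ℚ; 1ℚ; ½; _-_; -_; _<_; ∣_∣; nonNegative; positive)
open import Data.Rational.Properties
open import Data.Rational.Solver using (module +-*-Solver)
open import Data.Sum using (_⊎_; inj₁; inj₂; [_,_])
open import Data.Vec.Base using (_∷_; there)
open import Function.Bundles using (Equivalence)
open import Relation.Binary.PropositionalEquality hiding ([_])
open import Relation.Nullary using (Dec; yes; no; does; ¬_; contradiction)
open import Relation.Nullary.Decidable using (dec-true; dec-false)

open import Algebra.Properties.Group +-0-group using () renaming (∙-cancelʳ to +-cancelʳ-≡)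
open import Algebra.Properties.Semiring.Sum (CommutativeRing.semiring +-*-commutativeRing)
  using (sum; sum-replicate-zero; ∑-distrib-+; *-distribˡ-sum)

open +-*-Solver

-- For a heavy s and a path p from s to some t ∈ S* ∖ S, the swap that hands
-- all clients of s over to t is not admissible, hence f_s ≤ f_t + U·d(s,t)
-- ≤ f_t + U·c(p). The swap paths of s weigh at least U/2 in total, so
-- (U/2)·f_s ≤ Σ_p w(p)·(f_t + U·c(p)) over these paths.
-- Summing over H, the f_t-terms contribute at most U·c_f(S* ∖ S): every such
-- path enters its end t ∉ S along an edge carrying x*-flow out of t, and that
-- flow totals at most U. Dividing by U/2 gives the claim (for U = 0 there is
-- no heavy facility); the transfer and penalty terms are nonnegative slack.

p≤p+q : ∀ {p q} → 0ℚ ≤ q → p ≤ p + q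
p≤p+q {p} 0≤q = ≤-trans (≤-reflexive (sym (+-identityʳ p))) (+-monoʳ-≤ p 0≤q)

p≤q⇒0≤q-p : ∀ {p q} → p ≤ q → 0ℚ ≤ q - p
p≤q⇒0≤q-p {p} p≤q = ≤-trans (≤-reflexive (sym (+-inverseʳ p))) (+-monoˡ-≤ (- p) p≤q)

<⇒≱ : ∀ {p q} → p < q → ¬ (q ≤ p)
<⇒≱ p<q q≤p = <-irrefl refl (<-≤-trans p<q q≤p)

*-nonneg : ∀ {p q} → 0ℚ ≤ p → 0ℚ ≤ q → 0ℚ ≤ p * q
*-nonneg {p} {q} 0≤p 0≤q =
  nonNegative⁻¹ (p * q) {{nonNeg*nonNeg⇒nonNeg p {{nonNegative 0≤p}} q {{nonNegative 0≤q}}}}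

*-monoˡ-≤ : ∀ r {p q} → 0ℚ ≤ r → p ≤ q → r * p ≤ r * q
*-monoˡ-≤ r 0≤r = *-monoˡ-≤-nonNeg r {{nonNegative 0≤r}}

*-monoʳ-≤ : ∀ r {p q} → 0ℚ ≤ r → p ≤ q → p * r ≤ q * r
*-monoʳ-≤ r 0≤r = *-monoʳ-≤-nonNeg r {{nonNegative 0≤r}}

+-cancelʳ-≤ : ∀ p q r → p + r ≤ q + r → p ≤ q
+-cancelʳ-≤ p q r p+r≤q+r = begin
  p             ≡⟨ solve 2 (λ p r → p := (p :+ r) :- r) refl p r ⟩
  (p + r) - r   ≤⟨ +-monoˡ-≤ (- r) p+r≤q+r ⟩
  (q + r) - r   ≡⟨ solve 2 (λ q r → (q :+ r) :- r := q) refl q r ⟩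
  q             ∎
  where open ≤-Reasoning

∧⁻ : ∀ {a b} → T (a ∧ b) → T a × T b
∧⁻ = Equivalence.to T-∧

∧⁺ : ∀ {a b} → T a → T b → T (a ∧ b)
∧⁺ ta tb = Equivalence.from T-∧ (ta , tb)

does⇒ : ∀ {A : Set} (a? : Dec A) → T (does a?) → A
does⇒ (yes a) _ = a

notDoes⇒ : ∀ {A : Set} (a? : Dec A) → T (not (does a?)) → ¬ A
notDoes⇒ (no ¬a) _ = ¬a

when-T : ∀ {b} q → T b → when b q ≡ q
when-T {true} q _ = refl

when-0 : ∀ b → when b 0ℚ ≡ 0ℚ
when-0 true  = refl
when-0 false = refl

when-nonneg : ∀ b {q} → 0ℚ ≤ q → 0ℚ ≤ when b q
when-nonneg true  0≤q = 0≤q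
when-nonneg false _   = ≤-refl

when-≤ : ∀ b {p q} → 0ℚ ≤ q → (T b → p ≤ q) → when b p ≤ q
when-≤ true  _   p≤q = p≤q _
when-≤ false 0≤q _   = 0≤q

when-mono-≤ : ∀ b {p q} → (T b → p ≤ q) → when b p ≤ when b q
when-mono-≤ true  p≤q = p≤q _
when-mono-≤ false _   = ≤-refl

when-+ : ∀ b p q → when b (p + q) ≡ when b p + when b q
when-+ true  p q = refl
when-+ false p q = refl

*-when : ∀ p b q → p * when b q ≡ when b (p * q)
*-when p true  q = refl
*-when p false q = *-zeroʳ p

when-* : ∀ b p q → when b p * q ≡ when b (p * q)
when-* true  p q = refl
when-* false p q = *-zeroˡ q

when-nest : ∀ h e w f → when h (when e w * f) ≡ when (h ∧ e) (w * f)
when-nest true  e w f = when-* e w f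
when-nest false e w f = refl

when-hoist-∧ : ∀ b h e w f → when h (when (b ∧ e) w * f) ≡ when b (when h (when e w * f))
when-hoist-∧ true  h e w f = refl
when-hoist-∧ false h e w f = trans (cong (when h) (*-zeroˡ f)) (when-0 h)

δ : ∀ {n} → Fin n → Fin n → ℚ → ℚ
δ i k = when (does (i Fin.≟ k))

δ-diag : ∀ {n} (k : Fin n) q → δ k k q ≡ q
δ-diag k q rewrite dec-true (k Fin.≟ k) refl = refl

δ-off : ∀ {n} {i k : Fin n} q → i ≢ k → δ i k q ≡ 0ℚ
δ-off {i = i} {k} q i≢k rewrite dec-false (i Fin.≟ k) i≢k = refl

ΣFin≡sum : ∀ {n} (f : Fin n → ℚ) → ΣFin f ≡ sum f
ΣFin≡sum {zero}  f = refl
ΣFin≡sum {suc n} f = cong (f Fin.zero +_) (ΣFin≡sum (λ i → f (Fin.suc i)))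

ΣFin-cong : ∀ {n} {f g : Fin n → ℚ} → (∀ i → f i ≡ g i) → ΣFin f ≡ ΣFin g
ΣFin-cong {zero}  f≗g = refl
ΣFin-cong {suc n} f≗g = cong₂ _+_ (f≗g Fin.zero) (ΣFin-cong (λ i → f≗g (Fin.suc i)))

ΣFin-mono-≤ : ∀ {n} {f g : Fin n → ℚ} → (∀ i → f i ≤ g i) → ΣFin f ≤ ΣFin g
ΣFin-mono-≤ {zero}  f≤g = ≤-refl
ΣFin-mono-≤ {suc n} f≤g = +-mono-≤ (f≤g Fin.zero) (ΣFin-mono-≤ (λ i → f≤g (Fin.suc i)))

ΣFin-zero : ∀ n → ΣFin {n} (λ _ → 0ℚ) ≡ 0ℚ
ΣFin-zero n = trans (ΣFin≡sum (λ (_ : Fin n) → 0ℚ)) (sum-replicate-zero n)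

ΣFin-nonneg : ∀ {n} {f : Fin n → ℚ} → (∀ i → 0ℚ ≤ f i) → 0ℚ ≤ ΣFin f
ΣFin-nonneg {n} 0≤f = ≤-trans (≤-reflexive (sym (ΣFin-zero n))) (ΣFin-mono-≤ 0≤f)

ΣFin-distrib-+ : ∀ {n} (f g : Fin n → ℚ) → ΣFin (λ i → f i + g i) ≡ ΣFin f + ΣFin g
ΣFin-distrib-+ f g = begin
  ΣFin (λ i → f i + g i)  ≡⟨ ΣFin≡sum (λ i → f i + g i) ⟩
  sum (λ i → f i + g i)   ≡⟨ ∑-distrib-+ f g ⟩
  sum f + sum g           ≡⟨ cong₂ _+_ (ΣFin≡sum f) (ΣFin≡sum g) ⟨
  ΣFin f + ΣFin g         ∎
  where open ≡-Reasoning

*-distribˡ-ΣFin : ∀ {n} p (f : Fin n → ℚ) → p * ΣFin f ≡ ΣFin (λ i → p * f i)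
*-distribˡ-ΣFin p f = begin
  p * ΣFin f              ≡⟨ cong (p *_) (ΣFin≡sum f) ⟩
  p * sum f               ≡⟨ *-distribˡ-sum p f ⟩
  sum (λ i → p * f i)     ≡⟨ ΣFin≡sum (λ i → p * f i) ⟨
  ΣFin (λ i → p * f i)    ∎
  where open ≡-Reasoning

ΣFin-when : ∀ {n} b (f : Fin n → ℚ) → ΣFin (λ i → when b (f i)) ≡ when b (ΣFin f)
ΣFin-when     true  f = refl
ΣFin-when {n} false f = ΣFin-zero n

ΣFin-δ : ∀ {n} (k : Fin n) (f : Fin n → ℚ) → ΣFin (λ i → δ i k (f i)) ≡ f k
ΣFin-δ {suc n} Fin.zero    f = trans (cong (f Fin.zero +_) (ΣFin-zero n)) (+-identityʳ _)
ΣFin-δ {suc n} (Fin.suc k) f = trans (+-identityˡ _) (ΣFin-δ k (λ i → f (Fin.suc i)))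

term≤ΣFin : ∀ {n} {f : Fin n → ℚ} → (∀ i → 0ℚ ≤ f i) → ∀ k → f k ≤ ΣFin f
term≤ΣFin {f = f} 0≤f k = begin
  f k                        ≡⟨ ΣFin-δ k f ⟨
  ΣFin (λ i → δ i k (f i))   ≤⟨ ΣFin-mono-≤ δ≤ ⟩
  ΣFin f                     ∎
  where
  open ≤-Reasoning
  δ≤ : ∀ i → δ i k (f i) ≤ f i
  δ≤ i with does (i Fin.≟ k)
  ... | true  = ≤-refl
  ... | false = 0≤f i

ΣFin-exchange : ∀ {n} {f f′ g : Fin n → ℚ} (s t : Fin n) →
  (∀ i → f′ i + δ i s (g i) ≡ f i + δ i t (g i)) → ΣFin f′ + g s ≡ ΣFin f + g t
ΣFin-exchange {f = f} {f′} {g} s t f′≈f = begin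
  ΣFin f′ + g s                          ≡⟨ cong (ΣFin f′ +_) (ΣFin-δ s g) ⟨
  ΣFin f′ + ΣFin (λ i → δ i s (g i))     ≡⟨ ΣFin-distrib-+ f′ _ ⟨
  ΣFin (λ i → f′ i + δ i s (g i))        ≡⟨ ΣFin-cong f′≈f ⟩
  ΣFin (λ i → f i + δ i t (g i))         ≡⟨ ΣFin-distrib-+ f _ ⟩
  ΣFin f + ΣFin (λ i → δ i t (g i))      ≡⟨ cong (ΣFin f +_) (ΣFin-δ t g) ⟩
  ΣFin f + g t                           ∎
  where open ≡-Reasoning

module _ {A : Set} where

  ΣList-cong : ∀ {f g : A → ℚ} (l : List A) → (∀ a → f a ≡ g a) → ΣList f l ≡ ΣList g l
  ΣList-cong []      f≗g = refl
  ΣList-cong (a ∷ l) f≗g = cong₂ _+_ (f≗g a) (ΣList-cong l f≗g)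

  ΣList-mono-≤ : ∀ {R : A → Set} {f g : A → ℚ} {l : List A} → All R l →
                 (∀ a → R a → f a ≤ g a) → ΣList f l ≤ ΣList g l
  ΣList-mono-≤ []       f≤g = ≤-refl
  ΣList-mono-≤ (r ∷ rs) f≤g = +-mono-≤ (f≤g _ r) (ΣList-mono-≤ rs f≤g)

  ΣList-zero : ∀ (l : List A) → ΣList (λ _ → 0ℚ) l ≡ 0ℚ
  ΣList-zero []      = refl
  ΣList-zero (a ∷ l) = trans (+-identityˡ _) (ΣList-zero l)

  ΣList-nonneg : ∀ {f : A → ℚ} (l : List A) → (∀ a → 0ℚ ≤ f a) → 0ℚ ≤ ΣList f l
  ΣList-nonneg []      0≤f = ≤-refl
  ΣList-nonneg (a ∷ l) 0≤f = +-mono-≤ (0≤f a) (ΣList-nonneg l 0≤f)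

  ΣList-distrib-+ : ∀ (f g : A → ℚ) (l : List A) →
                    ΣList (λ a → f a + g a) l ≡ ΣList f l + ΣList g l
  ΣList-distrib-+ f g []      = refl
  ΣList-distrib-+ f g (a ∷ l) = trans (cong (f a + g a +_) (ΣList-distrib-+ f g l))
    (solve 4 (λ p q r s → (p :+ q) :+ (r :+ s) := (p :+ r) :+ (q :+ s)) refl
      (f a) (g a) (ΣList f l) (ΣList g l))

  *-distribˡ-ΣList : ∀ p (f : A → ℚ) (l : List A) → p * ΣList f l ≡ ΣList (λ a → p * f a) l
  *-distribˡ-ΣList p f []      = *-zeroʳ p
  *-distribˡ-ΣList p f (a ∷ l) =
    trans (*-distribˡ-+ p (f a) (ΣList f l)) (cong (p * f a +_) (*-distribˡ-ΣList p f l))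

  *-distribʳ-ΣList : ∀ p (f : A → ℚ) (l : List A) → ΣList f l * p ≡ ΣList (λ a → f a * p) l
  *-distribʳ-ΣList p f []      = *-zeroˡ p
  *-distribʳ-ΣList p f (a ∷ l) =
    trans (*-distribʳ-+ p (f a) (ΣList f l)) (cong (f a * p +_) (*-distribʳ-ΣList p f l))

  ΣList-when : ∀ b (f : A → ℚ) (l : List A) → ΣList (λ a → when b (f a)) l ≡ when b (ΣList f l)
  ΣList-when true  f l       = refl
  ΣList-when false f []      = refl
  ΣList-when false f (a ∷ l) = trans (+-identityˡ _) (ΣList-when false f l)

  ΣList-ΣFin-comm : ∀ {n} (f : A → Fin n → ℚ) (l : List A) →
    ΣList (λ a → ΣFin (f a)) l ≡ ΣFin (λ i → ΣList (λ a → f a i) l)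
  ΣList-ΣFin-comm {n} f []      = sym (ΣFin-zero n)
  ΣList-ΣFin-comm     f (a ∷ l) =
    trans (cong (ΣFin (f a) +_) (ΣList-ΣFin-comm f l)) (sym (ΣFin-distrib-+ (f a) _))

  term≤ΣList : ∀ {f : A → ℚ} {a l} → (∀ b → 0ℚ ≤ f b) → a ∈ₗ l → f a ≤ ΣList f l
  term≤ΣList {l = b ∷ l} 0≤f (here refl) = p≤p+q (ΣList-nonneg l 0≤f)
  term≤ΣList {f = f} {a} {b ∷ l} 0≤f (there a∈l) = begin
    f a               ≤⟨ term≤ΣList 0≤f a∈l ⟩
    ΣList f l         ≡⟨ +-identityˡ _ ⟨
    0ℚ + ΣList f l    ≤⟨ +-monoˡ-≤ _ (0≤f b) ⟩
    f b + ΣList f l   ∎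
    where open ≤-Reasoning

atFac : ∀ {nF} → (Fin nF → ℚ) → FV nF → ℚ
atFac g (fac i) = g i
atFac g dN      = 0ℚ
atFac g dN*     = 0ℚ

atFac-nonneg : ∀ {nF} {g : Fin nF → ℚ} → (∀ i → 0ℚ ≤ g i) → ∀ a → 0ℚ ≤ atFac g a
atFac-nonneg 0≤g (fac i) = 0≤g i
atFac-nonneg 0≤g dN      = ≤-refl
atFac-nonneg 0≤g dN*     = ≤-refl

endAux-edge : ∀ {nF nC} (p : Path nF nC) a st →
  endAux p a st ≡ a ⊎ ∃ λ j → ∃ λ d → (endAux p a st , j , d) ∈ₗ edgesAux p a st
endAux-edge p a [] = inj₁ refl
endAux-edge p a ((j , b) ∷ st) with endAux-edge p b st
... | inj₁ end≡b         = inj₂ (j , bwd , there (here (cong (λ e → e , j , bwd) end≡b)))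
... | inj₂ (j′ , d , e∈) = inj₂ (j′ , d , there (there e∈))

-- The swap inequality

x∉p-x : ∀ {n} (p : Subset n) (x : Fin n) → x ∉ p Subset.- x
x∉p-x (_ ∷ p) Fin.zero    ()
x∉p-x (_ ∷ p) (Fin.suc x) (there x∈p-x) = x∉p-x p x x∈p-x

data Site {n} (s t : Fin n) : Fin n → Set where
  source : Site s t s
  target : t ≢ s → Site s t t
  other  : ∀ {i} → i ≢ s → i ≢ t → Site s t i

site : ∀ {n} (s t i : Fin n) → Site s t i
site s t i with i Fin.≟ s | i Fin.≟ t
... | yes refl | _        = source
... | no i≢s   | yes refl = target i≢s
... | no i≢s   | no i≢t   = other i≢s i≢t

-- cf + A + P and cf′ + A′ + P are the costs before and after the swap; fs, ft
-- are the opening costs and Ts, Tt the connection costs of the moved clients.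
exchange-bound : ∀ {cf A P cf′ A′ fs ft Ts Tt D} →
  cf + A + P ≤ cf′ + A′ + P → cf′ + fs ≡ cf + ft → A′ + Ts ≡ A + Tt → Tt ≤ Ts + D →
  fs ≤ ft + D
exchange-bound {cf} {A} {P} {cf′} {A′} {fs} {ft} {Ts} {Tt} {D} cost≤ cf-eq A-eq Tt≤ =
  +-cancelʳ-≤ fs (ft + D) (cf + A + P + Ts) (begin
    fs + (cf + A + P + Ts)        ≤⟨ +-monoʳ-≤ fs (+-monoˡ-≤ Ts cost≤) ⟩
    fs + (cf′ + A′ + P + Ts)      ≡⟨ solve 5 (λ fs cf′ A′ P Ts → fs :+ (cf′ :+ A′ :+ P :+ Ts)
                                      := (cf′ :+ fs) :+ (A′ :+ Ts) :+ P) refl fs cf′ A′ P Ts ⟩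
    (cf′ + fs) + (A′ + Ts) + P    ≡⟨ cong₂ (λ u v → u + v + P) cf-eq A-eq ⟩
    (cf + ft) + (A + Tt) + P      ≤⟨ +-monoˡ-≤ P (+-monoʳ-≤ (cf + ft) (+-monoʳ-≤ A Tt≤)) ⟩
    (cf + ft) + (A + (Ts + D)) + P
      ≡⟨ solve 6 (λ cf ft A Ts D P → (cf :+ ft) :+ (A :+ (Ts :+ D)) :+ P
                   := (ft :+ D) :+ (cf :+ A :+ P :+ Ts)) refl cf ft A Ts D P ⟩
    (ft + D) + (cf + A + P + Ts)  ∎)
  where open ≤-Reasoning

module _ {nF nC} (I : Instance nF nC) where
  open Instance I

  connCost : Assign nF nC → ℚ
  connCost x = ΣFin (λ i → ΣFin (λ j → c i j * x i j))

  penCost : Assign nF nC → ℚ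
  penCost x = ΣFin (λ j → pen j * (dem j - served I x j))

  module SwapMove {S : Subset nF} {x : Assign nF nC} (feas : Feasible I S x)
                  {s t : Fin nF} (s∈S : s ∈ S) (t∉S : t ∉ S) where

    x≥0 : ∀ i j → 0ℚ ≤ x i j
    x≥0 = proj₁ feas

    x-outside : ∀ i j → i ∉ S → x i j ≡ 0ℚ
    x-outside = proj₁ (proj₂ feas)

    x-cap : ∀ i → ΣFin (x i) ≤ U
    x-cap = proj₁ (proj₂ (proj₂ feas))

    t≢s : t ≢ s
    t≢s refl = t∉S s∈S

    S′ : Subset nF
    S′ = swapSet I S s t

    s∉S′ : s ∉ S′
    s∉S′ = x∉p-x (S ∪ ⁅ t ⁆) s

    t∈S′ : t ∈ S′
    t∈S′ = x∈p∧x≢y⇒x∈p-y (x∈p∪q⁺ (inj₂ (x∈⁅x⁆ t))) t≢s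

    ∈S′⁺ : ∀ {i} → i ∈ S → i ≢ s → i ∈ S′
    ∈S′⁺ i∈S i≢s = x∈p∧x≢y⇒x∈p-y (x∈p∪q⁺ (inj₁ i∈S)) i≢s

    ∈S′⁻ : ∀ {i} → i ∈ S′ → i ∈ S ⊎ i ≡ t
    ∈S′⁻ i∈S′ with x∈p∪q⁻ S ⁅ t ⁆ (p─q⊆p _ ⁅ s ⁆ i∈S′)
    ... | inj₁ i∈S   = inj₁ i∈S
    ... | inj₂ i∈⁅t⁆ = inj₂ (x∈⁅y⁆⇒x≡y t i∈⁅t⁆)

    moveRow : Assign nF nC
    moveRow i j = (x i j + δ i t (x s j)) - δ i s (x s j)

    moveRow-exchange : ∀ i j → moveRow i j + δ i s (x s j) ≡ x i j + δ i t (x s j)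
    moveRow-exchange i j = solve 3 (λ a b e → (a :+ b) :- e :+ e := a :+ b) refl
      (x i j) (δ i t (x s j)) (δ i s (x s j))

    moveRow-source : ∀ j → moveRow s j ≡ 0ℚ
    moveRow-source j rewrite δ-off (x s j) (λ s≡t → t≢s (sym s≡t)) | δ-diag s (x s j) =
      solve 1 (λ a → (a :+ con 0ℚ) :- a := con 0ℚ) refl (x s j)

    moveRow-target : ∀ j → moveRow t j ≡ x s j
    moveRow-target j rewrite δ-diag t (x s j) | δ-off (x s j) t≢s | x-outside t j t∉S =
      solve 1 (λ a → (con 0ℚ :+ a) :- con 0ℚ := a) refl (x s j)

    moveRow-other : ∀ {i} j → i ≢ s → i ≢ t → moveRow i j ≡ x i j
    moveRow-other {i} j i≢s i≢t rewrite δ-off (x s j) i≢s | δ-off (x s j) i≢t =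
      solve 1 (λ a → (a :+ con 0ℚ) :- con 0ℚ := a) refl (x i j)

    served-moveRow : ∀ j → served I moveRow j ≡ served I x j
    served-moveRow j = +-cancelʳ-≡ (x s j) _ _ (ΣFin-exchange s t (λ i → moveRow-exchange i j))

    moveRow-feasible : Feasible I S′ moveRow
    moveRow-feasible = nonneg , outside , cap , demand
      where
      nonneg : ∀ i j → 0ℚ ≤ moveRow i j
      nonneg i j with site s t i
      ... | source        = ≤-reflexive (sym (moveRow-source j))
      ... | target _      = ≤-trans (x≥0 s j) (≤-reflexive (sym (moveRow-target j)))
      ... | other i≢s i≢t = ≤-trans (x≥0 i j) (≤-reflexive (sym (moveRow-other j i≢s i≢t)))
      outside : ∀ i j → i ∉ S′ → moveRow i j ≡ 0ℚ
      outside i j i∉S′ with site s t i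
      ... | source        = moveRow-source j
      ... | target _      = contradiction t∈S′ i∉S′
      ... | other i≢s i≢t =
        trans (moveRow-other j i≢s i≢t) (x-outside i j (λ i∈S → i∉S′ (∈S′⁺ i∈S i≢s)))
      cap : ∀ i → ΣFin (moveRow i) ≤ U
      cap i with site s t i
      ... | source        =
        ≤-trans (≤-reflexive (trans (ΣFin-cong moveRow-source) (ΣFin-zero nC))) U-nonneg
      ... | target _      = ≤-trans (≤-reflexive (ΣFin-cong moveRow-target)) (x-cap s)
      ... | other i≢s i≢t =
        ≤-trans (≤-reflexive (ΣFin-cong (λ j → moveRow-other j i≢s i≢t))) (x-cap i)
      demand : ∀ j → served I moveRow j ≤ dem j
      demand j = ≤-trans (≤-reflexive (served-moveRow j)) (proj₂ (proj₂ (proj₂ feas)) j)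

    cf-swap : cf I S′ + fcost s ≡ cf I S + fcost t
    cf-swap = ΣFin-exchange s t opened
      where
      opened : ∀ i → when (does (i ∈? S′)) (fcost i) + δ i s (fcost i)
                   ≡ when (does (i ∈? S)) (fcost i) + δ i t (fcost i)
      opened i with site s t i
      ... | source rewrite dec-false (s ∈? S′) s∉S′ | dec-true (s ∈? S) s∈S
                         | δ-diag s (fcost s) | δ-off (fcost s) (λ s≡t → t≢s (sym s≡t)) =
        +-comm 0ℚ (fcost s)
      ... | target _ rewrite dec-true (t ∈? S′) t∈S′ | dec-false (t ∈? S) t∉S
                           | δ-diag t (fcost t) | δ-off (fcost t) t≢s =
        +-comm (fcost t) 0ℚ
      ... | other i≢s i≢t rewrite δ-off (fcost i) i≢s | δ-off (fcost i) i≢t =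
        cong (λ b → when b (fcost i) + 0ℚ) same-membership
        where
        same-membership : does (i ∈? S′) ≡ does (i ∈? S)
        same-membership with i ∈? S
        ... | yes i∈S = dec-true (i ∈? S′) (∈S′⁺ i∈S i≢s)
        ... | no  i∉S = dec-false (i ∈? S′) (λ i∈S′ → [ i∉S , i≢t ] (∈S′⁻ i∈S′))

    servedFrom : Fin nF → ℚ
    servedFrom i = ΣFin (λ j → c i j * x s j)

    connCost-moveRow : connCost moveRow + servedFrom s ≡ connCost x + servedFrom t
    connCost-moveRow = ΣFin-exchange s t row
      where
      row : ∀ i → ΣFin (λ j → c i j * moveRow i j) + δ i s (servedFrom i)
                ≡ ΣFin (λ j → c i j * x i j) + δ i t (servedFrom i)
      row i = begin
        ΣFin (λ j → c i j * moveRow i j) + δ i s (servedFrom i)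
          ≡⟨ cong (ΣFin (λ j → c i j * moveRow i j) +_) (pull s) ⟨
        ΣFin (λ j → c i j * moveRow i j) + ΣFin (λ j → δ i s (c i j * x s j))
          ≡⟨ ΣFin-distrib-+ {nC} _ _ ⟨
        ΣFin (λ j → c i j * moveRow i j + δ i s (c i j * x s j))
          ≡⟨ ΣFin-cong scaled ⟩
        ΣFin (λ j → c i j * x i j + δ i t (c i j * x s j))
          ≡⟨ ΣFin-distrib-+ {nC} _ _ ⟩
        ΣFin (λ j → c i j * x i j) + ΣFin (λ j → δ i t (c i j * x s j))
          ≡⟨ cong (ΣFin (λ j → c i j * x i j) +_) (pull t) ⟩
        ΣFin (λ j → c i j * x i j) + δ i t (servedFrom i)
          ∎
        where
        open ≡-Reasoning
        pull : ∀ k → ΣFin (λ j → δ i k (c i j * x s j)) ≡ δ i k (servedFrom i)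
        pull k = ΣFin-when (does (i Fin.≟ k)) (λ j → c i j * x s j)
        scaled : ∀ j → c i j * moveRow i j + δ i s (c i j * x s j)
                     ≡ c i j * x i j + δ i t (c i j * x s j)
        scaled j = begin
          c i j * moveRow i j + δ i s (c i j * x s j)
            ≡⟨ cong (c i j * moveRow i j +_) (*-when (c i j) _ (x s j)) ⟨
          c i j * moveRow i j + c i j * δ i s (x s j)
            ≡⟨ *-distribˡ-+ (c i j) _ _ ⟨
          c i j * (moveRow i j + δ i s (x s j))
            ≡⟨ cong (c i j *_) (moveRow-exchange i j) ⟩
          c i j * (x i j + δ i t (x s j))
            ≡⟨ *-distribˡ-+ (c i j) _ _ ⟩
          c i j * x i j + c i j * δ i t (x s j)
            ≡⟨ cong (c i j * x i j +_) (*-when (c i j) _ (x s j)) ⟩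
          c i j * x i j + δ i t (c i j * x s j)
            ∎

    servedFrom-target : servedFrom t ≤ servedFrom s + U * dist (fpt s) (fpt t)
    servedFrom-target = begin
      ΣFin (λ j → c t j * x s j)               ≤⟨ ΣFin-mono-≤ (λ j → *-monoʳ-≤ (x s j) (x≥0 s j) (via-s j)) ⟩
      ΣFin (λ j → (c s j + d) * x s j)         ≡⟨ ΣFin-cong (λ j → *-distribʳ-+ (x s j) (c s j) d) ⟩
      ΣFin (λ j → c s j * x s j + d * x s j)   ≡⟨ ΣFin-distrib-+ {nC} _ _ ⟩
      servedFrom s + ΣFin (λ j → d * x s j)    ≡⟨ cong (servedFrom s +_) (*-distribˡ-ΣFin d (x s)) ⟨
      servedFrom s + d * ΣFin (x s)            ≤⟨ +-monoʳ-≤ (servedFrom s) (*-monoˡ-≤ d (dist-nonneg _ _) (x-cap s)) ⟩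
      servedFrom s + d * U                     ≡⟨ cong (servedFrom s +_) (*-comm d U) ⟩
      servedFrom s + U * d                     ∎
      where
      open ≤-Reasoning
      d = dist (fpt s) (fpt t)
      via-s : ∀ j → c t j ≤ c s j + d
      via-s j = ≤-trans (dist-tri (fpt t) (fpt s) (cpt j))
        (≤-reflexive (trans (cong (_+ c s j) (dist-sym (fpt t) (fpt s))) (+-comm d (c s j))))

    swap-bound : NoAdmissibleSwap I S x → fcost s ≤ fcost t + U * dist (fpt s) (fpt t)
    swap-bound noSwap = exchange-bound {cf I S} {connCost x} {penCost x} {cf I S′}
      cost≤ cf-swap connCost-moveRow servedFrom-target
      where
      cost≤ : cf I S + connCost x + penCost x ≤ cf I S′ + connCost moveRow + penCost x
      cost≤ = ≤-trans (noSwap s t s∈S t∉S moveRow moveRow-feasible)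
        (≤-reflexive (cong (cf I S′ + connCost moveRow +_)
          (ΣFin-cong (λ j → cong (λ q → pen j * (dem j - q)) (served-moveRow j)))))

  -- Charging the heavy facilities along the path decomposition

  module Charging {S S* : Subset nF} {x x* : Assign nF nC}
                  (feas : Feasible I S x) (feas* : Feasible I S* x*)
                  (P : List (ℚ × Path nF nC)) (dec : IsPathDecomp I S S* x x* P)
                  (noSwap : NoAdmissibleSwap I S x) where

    Valid : ℚ × Path nF nC → Set
    Valid = ValidPath I S S* x x*

    valid : All Valid P
    valid = proj₁ dec

    weight-nonneg : ∀ {q} → Valid q → 0ℚ ≤ proj₁ q
    weight-nonneg v = <⇒≤ (proj₁ v)

    pcost : Path nF nC → ℚ
    pcost = pathCost I S S* x x*

    edgeCost : FV nF × Fin nC × Dir → ℚ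
    edgeCost (a , j , _) = ucost I S S* x x* a j

    pcost-nonneg : ∀ p → 0ℚ ≤ pcost p
    pcost-nonneg p = ΣList-nonneg (edges p) edgeCost-nonneg
      where
      edgeCost-nonneg : ∀ e → 0ℚ ≤ edgeCost e
      edgeCost-nonneg (fac _ , _ , _) = dist-nonneg _ _
      edgeCost-nonneg (dN    , j , _) = pen-nonneg j
      edgeCost-nonneg (dN*   , j , _) = pen-nonneg j

    -- A conforming path cannot enter N, since x serves at most the demand,
    -- nor leave N*, since x* does not either; so between two facilities it
    -- only uses metric edges.
    dist≤edgesCost : ∀ (p : Path nF nC) i st {t} →
      All (Conforming I S S* x x*) (edgesAux p (fac i) st) → endAux p (fac i) st ≡ fac t →
      dist (fpt i) (fpt t) ≤ ΣList edgeCost (edgesAux p (fac i) st)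
    dist≤edgesCost p i [] _ refl = ≤-reflexive (dist-self _)
    dist≤edgesCost p i ((j , fac k) ∷ st) {t} (_ ∷ _ ∷ conf) end≡ = begin
      dist (fpt i) (fpt t)
        ≤⟨ dist-tri (fpt i) (cpt j) (fpt t) ⟩
      c i j + dist (cpt j) (fpt t)
        ≤⟨ +-monoʳ-≤ (c i j) (dist-tri (cpt j) (fpt k) (fpt t)) ⟩
      c i j + (dist (cpt j) (fpt k) + dist (fpt k) (fpt t))
        ≡⟨ cong (λ d → c i j + (d + dist (fpt k) (fpt t))) (dist-sym (cpt j) (fpt k)) ⟩
      c i j + (c k j + dist (fpt k) (fpt t))
        ≤⟨ +-monoʳ-≤ (c i j) (+-monoʳ-≤ (c k j) (dist≤edgesCost p k st conf end≡)) ⟩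
      c i j + (c k j + ΣList edgeCost (edgesAux p (fac k) st))
        ∎
      where open ≤-Reasoning
    dist≤edgesCost p i ((j , dN) ∷ _) (_ ∷ into-N ∷ _) _ =
      ⊥-elim (<⇒≱ into-N (p≤q⇒0≤q-p (proj₂ (proj₂ (proj₂ feas)) j)))
    dist≤edgesCost p i ((j , dN*) ∷ []) _ ()
    dist≤edgesCost p i ((j , dN*) ∷ (j′ , _) ∷ _) (_ ∷ _ ∷ out-of-N* ∷ _) _ =
      ⊥-elim (<⇒≱ out-of-N* (neg-antimono-≤ (p≤q⇒0≤q-p (proj₂ (proj₂ (proj₂ feas*)) j′))))

    dist≤pathCost : ∀ {s t} q → Valid q → start (proj₂ q) ≡ fac s → end (proj₂ q) ≡ fac t →
      dist (fpt s) (fpt t) ≤ pcost (proj₂ q)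
    dist≤pathCost (_ , p@(path _ st)) v refl end≡ =
      dist≤edgesCost p _ st (proj₂ (proj₂ (proj₂ (proj₂ (proj₂ v))))) end≡

    load : FV nF → ℚ × Path nF nC → ℚ
    load a q = ΣFin (λ j → ΣList (λ e → when (matchE I S S* x x* a j e) (proj₁ q)) (edges (proj₂ q)))

    load-nonneg : ∀ a q → 0ℚ ≤ proj₁ q → 0ℚ ≤ load a q
    load-nonneg a (_ , p) 0≤w =
      ΣFin-nonneg (λ j → ΣList-nonneg (edges p) (λ e → when-nonneg (matchE I S S* x x* a j e) 0≤w))

    weight≤load : ∀ {a j d} q → 0ℚ ≤ proj₁ q → (a , j , d) ∈ₗ edges (proj₂ q) → proj₁ q ≤ load a q
    weight≤load {a} {j} {d} (w , p) 0≤w e∈ = begin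
      w                                                          ≡⟨ when-T w (matchE-refl a) ⟨
      when (matchE I S S* x x* a j (a , j , d)) w                ≤⟨ term≤ΣList (λ _ → when-nonneg _ 0≤w) e∈ ⟩
      ΣList (λ e → when (matchE I S S* x x* a j e) w) (edges p)  ≤⟨ term≤ΣFin column-nonneg j ⟩
      load a (w , p)                                             ∎
      where
      open ≤-Reasoning
      column-nonneg : ∀ j → 0ℚ ≤ ΣList (λ e → when (matchE I S S* x x* a j e) w) (edges p)
      column-nonneg j = ΣList-nonneg (edges p) (λ e → when-nonneg _ 0≤w)
      j≟j : T (does (j Fin.≟ j))
      j≟j rewrite dec-true (j Fin.≟ j) refl = _
      matchE-refl : ∀ a → T (matchE I S S* x x* a j (a , j , d))
      matchE-refl (fac i) rewrite dec-true (i Fin.≟ i) refl = j≟j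
      matchE-refl dN      = j≟j
      matchE-refl dN*     = j≟j

    -- The paths use each edge at most |x − x*|, and at t ∉ S that is x*(t, j).
    load-capacity : ∀ t → t ∉ S → ΣList (load (fac t)) P ≤ U
    load-capacity t t∉S = begin
      ΣList (load (fac t)) P                          ≡⟨ ΣList-ΣFin-comm {n = nC} _ P ⟩
      ΣFin (usedW I S S* x x* P (fac t))              ≤⟨ ΣFin-mono-≤ (proj₁ (proj₂ dec) (fac t)) ⟩
      ΣFin (λ j → ∣ flow I S S* x x* (fac t) j ∣)     ≡⟨ ΣFin-cong ∣flow∣≡x* ⟩
      ΣFin (x* t)                                     ≤⟨ proj₁ (proj₂ (proj₂ feas*)) t ⟩
      U                                               ∎
      where
      open ≤-Reasoning
      ∣flow∣≡x* : ∀ j → ∣ flow I S S* x x* (fac t) j ∣ ≡ x* t j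
      ∣flow∣≡x* j rewrite proj₁ (proj₂ feas) t j t∉S = begin-equality
        ∣ 0ℚ - x* t j ∣   ≡⟨ cong ∣_∣ (+-identityˡ (- x* t j)) ⟩
        ∣ - x* t j ∣      ≡⟨ ∣-p∣≡∣p∣ (x* t j) ⟩
        ∣ x* t j ∣        ≡⟨ 0≤p⇒∣p∣≡p (proj₁ feas* t j) ⟩
        x* t j            ∎

    isHeavy : Fin nF → Bool
    isHeavy = heavy I S S* x x* P

    swapShare : Fin nF → ℚ × Path nF nC → ℚ
    swapShare s q = when (startsAt I S S* x x* s (proj₂ q) ∧ endsSw I S S* x x* (proj₂ q)) (proj₁ q)

    swapWeight : Fin nF → ℚ
    swapWeight s = ΣList (swapShare s) P

    inS*∖S : Fin nF → Bool
    inS*∖S t = does (t ∈? S*) ∧ not (does (t ∈? S))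

    heavySwap : Path nF nC → Bool
    heavySwap p = startsH I S S* x x* P p ∧ endsSw I S S* x x* p

    heavySwapValue : (Path nF nC → FV nF) → (Fin nF → ℚ) → ℚ × Path nF nC → ℚ
    heavySwapValue at g q = when (heavySwap (proj₂ q)) (proj₁ q * atFac g (at (proj₂ q)))

    isHeavy⇒ : ∀ {s} → T (isHeavy s) → s ∈ S × 0ℚ < swapWeight s × U * ½ ≤ swapWeight s
    isHeavy⇒ {s} h with ∧⁻ {does (s ∈? S)} h
    ... | s∈S , h′ with ∧⁻ {does (0ℚ <? swapWeight s)} (proj₂ (∧⁻ {not (does (s ∈? S*))} h′))
    ... | pos , half =
      does⇒ (s ∈? S) s∈S , does⇒ (0ℚ <? swapWeight s) pos , does⇒ (U * ½ ≤? swapWeight s) half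

    inS*∖S⇒∉S : ∀ {t} → T (inS*∖S t) → t ∉ S
    inS*∖S⇒∉S {t} h = notDoes⇒ (t ∈? S) (proj₂ (∧⁻ {does (t ∈? S*)} h))

    startsH⇒ : ∀ p → T (startsH I S S* x x* P p) → ∃ λ s → start p ≡ fac s × T (isHeavy s)
    startsH⇒ (path (fac s) _) h = s , refl , h

    endsSw⇒ : ∀ p → T (endsSw I S S* x x* p) → ∃ λ t → end p ≡ fac t × T (inS*∖S t)
    endsSw⇒ p h with end p | h
    ... | fac t | h′ = t , refl , h′

    startsAt-heavy : ∀ {s} p → T (isHeavy s) → T (startsAt I S S* x x* s p) →
                     T (startsH I S S* x x* P p)
    startsAt-heavy {s} (path (fac s₀) _) h at with does⇒ (s Fin.≟ s₀) at
    ... | refl = h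

    -- A heavy swap path starts in S and ends outside S, so its last edge is at its end.
    heavySwap-end : ∀ q → Valid q → T (heavySwap (proj₂ q)) →
      ∃ λ t → end (proj₂ q) ≡ fac t × T (inS*∖S t) × proj₁ q ≤ load (fac t) q
    heavySwap-end q@(_ , p) v hs
      with startsH⇒ p (proj₁ (∧⁻ hs)) | endsSw⇒ p (proj₂ (∧⁻ hs))
    ... | s , start≡ , h | t , end≡ , t∈
      with endAux-edge p (start p) (steps p)
    ... | inj₁ end≡start = ⊥-elim (inS*∖S⇒∉S t∈ (subst (_∈ S) s≡t (proj₁ (isHeavy⇒ h))))
      where
      s≡t : s ≡ t
      s≡t with trans (sym start≡) (trans (sym end≡start) end≡)
      ... | refl = refl
    ... | inj₂ (j , d , e∈) =
      t , end≡ , t∈ , weight≤load q (weight-nonneg v) (subst (λ a → (a , j , d) ∈ₗ edges p) end≡ e∈)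

    charge-path : ∀ {g} → (∀ t → 0ℚ ≤ g t) → ∀ q → Valid q →
      heavySwapValue end g q ≤ ΣFin (λ t → when (inS*∖S t) (g t * load (fac t) q))
    charge-path {g} 0≤g q v = when-≤ (heavySwap (proj₂ q)) (ΣFin-nonneg term-nonneg) bound
      where
      open ≤-Reasoning
      term-nonneg : ∀ t → 0ℚ ≤ when (inS*∖S t) (g t * load (fac t) q)
      term-nonneg t =
        when-nonneg (inS*∖S t) (*-nonneg (0≤g t) (load-nonneg (fac t) q (weight-nonneg v)))
      bound : T (heavySwap (proj₂ q)) →
        proj₁ q * atFac g (end (proj₂ q)) ≤ ΣFin (λ t → when (inS*∖S t) (g t * load (fac t) q))
      bound hs with heavySwap-end q v hs
      ... | t , end≡ , t∈ , w≤load = begin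
        proj₁ q * atFac g (end (proj₂ q))       ≡⟨ cong (λ a → proj₁ q * atFac g a) end≡ ⟩
        proj₁ q * g t                           ≡⟨ *-comm (proj₁ q) (g t) ⟩
        g t * proj₁ q                           ≤⟨ *-monoˡ-≤ (g t) (0≤g t) w≤load ⟩
        g t * load (fac t) q                    ≡⟨ when-T _ t∈ ⟨
        when (inS*∖S t) (g t * load (fac t) q)  ≤⟨ term≤ΣFin term-nonneg t ⟩
        ΣFin (λ t → when (inS*∖S t) (g t * load (fac t) q)) ∎

    charge : ∀ {g} → (∀ t → 0ℚ ≤ g t) →
      ΣList (heavySwapValue end g) P ≤ U * ΣFin (λ t → when (inS*∖S t) (g t))
    charge {g} 0≤g = begin
      ΣList (heavySwapValue end g) P
        ≤⟨ ΣList-mono-≤ valid (charge-path 0≤g) ⟩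
      ΣList (λ q → ΣFin (λ t → when (inS*∖S t) (g t * load (fac t) q))) P
        ≡⟨ ΣList-ΣFin-comm {n = nF} _ P ⟩
      ΣFin (λ t → ΣList (λ q → when (inS*∖S t) (g t * load (fac t) q)) P)
        ≡⟨ ΣFin-cong pull ⟩
      ΣFin (λ t → when (inS*∖S t) (g t * ΣList (load (fac t)) P))
        ≤⟨ ΣFin-mono-≤ capacity ⟩
      ΣFin (λ t → when (inS*∖S t) (g t * U))
        ≡⟨ ΣFin-cong (λ t → trans (cong (when (inS*∖S t)) (*-comm (g t) U))
                                  (sym (*-when U (inS*∖S t) (g t)))) ⟩
      ΣFin (λ t → U * when (inS*∖S t) (g t))
        ≡⟨ *-distribˡ-ΣFin U (λ t → when (inS*∖S t) (g t)) ⟨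
      U * ΣFin (λ t → when (inS*∖S t) (g t))
        ∎
      where
      open ≤-Reasoning
      pull : ∀ t → ΣList (λ q → when (inS*∖S t) (g t * load (fac t) q)) P
                 ≡ when (inS*∖S t) (g t * ΣList (load (fac t)) P)
      pull t = trans (ΣList-when (inS*∖S t) _ P)
                     (cong (when (inS*∖S t)) (sym (*-distribˡ-ΣList (g t) (load (fac t)) P)))
      capacity : ∀ t → when (inS*∖S t) (g t * ΣList (load (fac t)) P) ≤ when (inS*∖S t) (g t * U)
      capacity t = when-mono-≤ (inS*∖S t)
        (λ t∈ → *-monoˡ-≤ (g t) (0≤g t) (load-capacity t (inS*∖S⇒∉S t∈)))

    Σheavy-zero : ∀ (f : Fin nF → ℚ) → ΣFin (λ s → when (isHeavy s) (0ℚ * f s)) ≡ 0ℚ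
    Σheavy-zero f = trans
      (ΣFin-cong (λ s → trans (cong (when (isHeavy s)) (*-zeroˡ (f s))) (when-0 (isHeavy s))))
      (ΣFin-zero nF)

    Σheavy-path : ∀ (f : Fin nF → ℚ) q →
      ΣFin (λ s → when (isHeavy s) (swapShare s q * f s)) ≡ heavySwapValue start f q
    Σheavy-path f (w , p@(path (fac s₀) _)) = begin
      ΣFin (λ s → when (isHeavy s) (when (does (s Fin.≟ s₀) ∧ e) w * f s))
        ≡⟨ ΣFin-cong (λ s → when-hoist-∧ (does (s Fin.≟ s₀)) (isHeavy s) e w (f s)) ⟩
      ΣFin (λ s → δ s s₀ (when (isHeavy s) (when e w * f s)))
        ≡⟨ ΣFin-δ s₀ (λ s → when (isHeavy s) (when e w * f s)) ⟩
      when (isHeavy s₀) (when e w * f s₀)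
        ≡⟨ when-nest (isHeavy s₀) e w (f s₀) ⟩
      when (isHeavy s₀ ∧ e) (w * f s₀)
        ∎
      where
      open ≡-Reasoning
      e : Bool
      e = endsSw I S S* x x* p
    Σheavy-path f (_ , path dN _)  = Σheavy-zero f
    Σheavy-path f (_ , path dN* _) = Σheavy-zero f

    Σheavy≡Σpaths : ∀ (f : Fin nF → ℚ) →
      ΣFin (λ s → when (isHeavy s) (swapWeight s * f s)) ≡ ΣList (heavySwapValue start f) P
    Σheavy≡Σpaths f = begin
      ΣFin (λ s → when (isHeavy s) (swapWeight s * f s))
        ≡⟨ ΣFin-cong distribute ⟩
      ΣFin (λ s → ΣList (λ q → when (isHeavy s) (swapShare s q * f s)) P)
        ≡⟨ ΣList-ΣFin-comm {n = nF} _ P ⟨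
      ΣList (λ q → ΣFin (λ s → when (isHeavy s) (swapShare s q * f s))) P
        ≡⟨ ΣList-cong P (Σheavy-path f) ⟩
      ΣList (heavySwapValue start f) P
        ∎
      where
      open ≡-Reasoning
      distribute : ∀ s → when (isHeavy s) (swapWeight s * f s)
                       ≡ ΣList (λ q → when (isHeavy s) (swapShare s q * f s)) P
      distribute s = trans (cong (when (isHeavy s)) (*-distribʳ-ΣList (f s) (swapShare s) P))
                           (sym (ΣList-when (isHeavy s) _ P))

    heavySwap-cost : ∀ q → Valid q →
      heavySwapValue start fcost q
        ≤ when (heavySwap (proj₂ q)) (proj₁ q * atFac fcost (end (proj₂ q)) + U * (proj₁ q * pcost (proj₂ q)))
    heavySwap-cost q@(w , p) v = when-mono-≤ (heavySwap p) bound
      where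
      open ≤-Reasoning hiding (start)
      bound : T (heavySwap p) →
        w * atFac fcost (start p) ≤ w * atFac fcost (end p) + U * (w * pcost p)
      bound hs with startsH⇒ p (proj₁ (∧⁻ hs)) | heavySwap-end q v hs
      ... | s , start≡ , h | t , end≡ , t∈ , _ = begin
        w * atFac fcost (start p)         ≡⟨ cong (λ a → w * atFac fcost a) start≡ ⟩
        w * fcost s                       ≤⟨ *-monoˡ-≤ w (weight-nonneg v) fs≤ ⟩
        w * (fcost t + U * pcost p)        ≡⟨ solve 4 (λ w f u c → w :* (f :+ u :* c) := w :* f :+ u :* (w :* c))
                                                     refl w (fcost t) U (pcost p) ⟩
        w * fcost t + U * (w * pcost p)    ≡⟨ cong (λ a → w * atFac fcost a + U * (w * pcost p)) end≡ ⟨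
        w * atFac fcost (end p) + U * (w * pcost p) ∎
        where
        fs≤ : fcost s ≤ fcost t + U * pcost p
        fs≤ = begin
          fcost s
            ≤⟨ SwapMove.swap-bound feas (proj₁ (isHeavy⇒ h)) (inS*∖S⇒∉S t∈) noSwap ⟩
          fcost t + U * dist (fpt s) (fpt t)
            ≤⟨ +-monoʳ-≤ (fcost t) (*-monoˡ-≤ U U-nonneg (dist≤pathCost q v start≡ end≡)) ⟩
          fcost t + U * pcost p
            ∎

    cf-H cf-S*∖S v-SwH : ℚ
    cf-H = cfH I S S* x x* P
    cf-S*∖S = cfS*∖S I S S* x x* P
    v-SwH = vSwH I S S* x x* P

    halfU*cfH≤ : (U * ½) * cf-H ≤ U * cf-S*∖S + U * v-SwH
    halfU*cfH≤ = begin
      (U * ½) * cf-H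
        ≡⟨ *-distribˡ-ΣFin {nF} (U * ½) _ ⟩
      ΣFin (λ s → (U * ½) * when (isHeavy s) (fcost s))
        ≡⟨ ΣFin-cong (λ s → *-when (U * ½) (isHeavy s) (fcost s)) ⟩
      ΣFin (λ s → when (isHeavy s) ((U * ½) * fcost s))
        ≤⟨ ΣFin-mono-≤ (λ s → when-mono-≤ (isHeavy s)
             (λ h → *-monoʳ-≤ (fcost s) (fcost-nonneg s) (proj₂ (proj₂ (isHeavy⇒ h))))) ⟩
      ΣFin (λ s → when (isHeavy s) (swapWeight s * fcost s))
        ≡⟨ Σheavy≡Σpaths fcost ⟩
      ΣList (heavySwapValue start fcost) P
        ≤⟨ ΣList-mono-≤ valid heavySwap-cost ⟩
      ΣList (λ q → when (hs q) (proj₁ q * atFac fcost (end (proj₂ q)) + U * (proj₁ q * pcost (proj₂ q)))) P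
        ≡⟨ ΣList-cong P (λ q → trans (when-+ (hs q) _ _)
                                     (cong (heavySwapValue end fcost q +_) (sym (*-when U (hs q) _)))) ⟩
      ΣList (λ q → heavySwapValue end fcost q + U * when (hs q) (proj₁ q * pcost (proj₂ q))) P
        ≡⟨ trans (ΣList-distrib-+ _ _ P)
                 (cong (ΣList (heavySwapValue end fcost) P +_) (sym (*-distribˡ-ΣList U _ P))) ⟩
      ΣList (heavySwapValue end fcost) P + U * v-SwH
        ≤⟨ +-monoˡ-≤ (U * v-SwH) (charge fcost-nonneg) ⟩
      U * cf-S*∖S + U * v-SwH
        ∎
      where
      open ≤-Reasoning hiding (start)
      hs : ℚ × Path nF nC → Bool
      hs q = heavySwap (proj₂ q)

    no-heavy : U ≤ 0ℚ → ∀ s → ¬ T (isHeavy s)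
    no-heavy U≤0 s h = <⇒≱ (proj₁ (proj₂ (isHeavy⇒ h))) (begin
      swapWeight s                             ≤⟨ ΣList-mono-≤ valid share≤ ⟩
      ΣList (heavySwapValue end one) P         ≤⟨ charge (λ _ → 0≤1) ⟩
      U * ΣFin (λ t → when (inS*∖S t) 1ℚ)      ≤⟨ *-monoʳ-≤ _ (ΣFin-nonneg (λ t → when-nonneg (inS*∖S t) 0≤1)) U≤0 ⟩
      0ℚ * ΣFin (λ t → when (inS*∖S t) 1ℚ)     ≡⟨ *-zeroˡ (ΣFin (λ t → when (inS*∖S t) 1ℚ)) ⟩
      0ℚ                                       ∎)
      where
      open ≤-Reasoning hiding (start)
      one : Fin nF → ℚ
      one _ = 1ℚ
      0≤1 : 0ℚ ≤ 1ℚ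
      0≤1 = nonNegative⁻¹ 1ℚ
      share≤ : ∀ q → Valid q → swapShare s q ≤ heavySwapValue end one q
      share≤ q@(w , p) v =
        when-≤ _ (when-nonneg (heavySwap p) (*-nonneg (weight-nonneg v) (atFac-nonneg (λ _ → 0≤1) (end p))))
          λ at∧sw → let at , sw = ∧⁻ {startsAt I S S* x x* s p} at∧sw
                        t , end≡ , _ = endsSw⇒ p sw
                    in begin
                      w                       ≡⟨ *-identityʳ w ⟨
                      w * atFac one (fac t)   ≡⟨ cong (λ a → w * atFac one a) end≡ ⟨
                      w * atFac one (end p)   ≡⟨ when-T _ (∧⁺ (startsAt-heavy p h at) sw) ⟨
                      heavySwapValue end one q ∎

    vClass-nonneg : ∀ ends → 0ℚ ≤ vClass I S S* x x* P ends
    vClass-nonneg ends = ≤-trans (≤-reflexive (sym (ΣList-zero P)))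
      (ΣList-mono-≤ valid (λ q v → when-nonneg _ (*-nonneg (weight-nonneg v) (pcost-nonneg (proj₂ q)))))

    cfH≤ : cf-H ≤ 2ℚ * v-SwH + 2ℚ * cf-S*∖S
    cfH≤ with 0ℚ <? U
    ... | yes 0<U = *-cancelˡ-≤-pos (U * ½) {{pos*pos⇒pos U {{positive 0<U}} ½}} (begin
      (U * ½) * cf-H                              ≤⟨ halfU*cfH≤ ⟩
      U * cf-S*∖S + U * v-SwH                     ≡⟨ solve 3 (λ u a b → u :* a :+ u :* b
                                                       := (u :* con ½) :* (con 2ℚ :* b :+ con 2ℚ :* a))
                                                       refl U cf-S*∖S v-SwH ⟩
      (U * ½) * (2ℚ * v-SwH + 2ℚ * cf-S*∖S)       ∎)
      where open ≤-Reasoning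
    ... | no  0≮U = begin
      cf-H                         ≤⟨ ΣFin-mono-≤ (λ s → when-≤ (isHeavy s) ≤-refl
                                        (λ h → ⊥-elim (no-heavy (≮⇒≥ 0≮U) s h))) ⟩
      ΣFin (λ (_ : Fin nF) → 0ℚ)   ≡⟨ ΣFin-zero nF ⟩
      0ℚ                           ≤⟨ +-mono-≤ (*-nonneg 0≤2 (vClass-nonneg _))
                                               (*-nonneg 0≤2 (ΣFin-nonneg (λ i → when-nonneg _ (fcost-nonneg i)))) ⟩
      2ℚ * v-SwH + 2ℚ * cf-S*∖S    ∎
      where
      open ≤-Reasoning
      0≤2 : 0ℚ ≤ 2ℚ
      0≤2 = nonNegative⁻¹ 2ℚ

lemma7 : ∀ {nF nC} (I : Instance nF nC) (S S* : Subset nF) (x x* : Assign nF nC)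
    → Feasible I S x → MinCostFor I S x
    → Feasible I S* x* → Optimal I S* x*
    → (P : List (ℚ × Path nF nC)) → IsPathDecomp I S S* x x* P
    → NoAdmissibleSwap I S x
    → cfH I S S* x x* P
      ≤ (2ℚ * vSwH I S S* x x* P) + (2ℚ * cfS*∖S I S S* x x* P)
        + vTrH I S S* x x* P + vPenH I S S* x x* P
lemma7 I S S* x x* feas _ feas* _ P dec noSwap =
  ≤-trans cfH≤ (≤-trans (p≤p+q (vClass-nonneg _)) (p≤p+q (vClass-nonneg _)))
  where open Charging I feas feas* P dec noSwap
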